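{- Let $N$ be a positive integer and $k$ an odd positive integer. Then $\mu_{k,N}(n)=0$ for all $n\ge1$, where $$\mu_{k,N}(n):=\sum_{m=-n}^{n}\binom{m+\lfloor\frac{k-1}{2}\rfloor}{k}M_{S_2}(m,n).$$
   Context: Here $\binom{x}{k}=\frac{x(x-1)\cdots(x-k+1)}{k!}$ for any integer $x$. For a partition $\pi$, $|\pi|$ is the sum of its parts, $\#(\pi)$ its number of parts, and $l(\pi)$ its largest part ($0$ if empty). Let $S_2$ be the set of triples $\vec\pi=(\pi_1,\pi_2,\pi_3)$ where $\pi_1$ is a partition into distinct parts and $\pi_2,\pi_3$ are partitions (all possibly empty), with $l(\pi_1),l(\pi_2),l(\pi_3)\le N$. Set $|\vec\pi|=|\pi_1|+|\pi_2|+|\pi_3|$, weight $w_c(\vec\pi)=(-1)^{\#(\pi_1)}$ and $\mathrm{crank}(\vec\pi)=\#(\pi_2)-\#(\pi_3)$. Define $M_{S_2}(m,n)=\sum_{\vec\pi\in S_2,\ |\vec\pi|=n,\ \mathrm{crank}(\vec\pi)=m} w_c(\vec\pi)$. -}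

module Defs where

open import Data.Nat as ℕ using (ℕ; zero; suc; _≥_; _>_; _∸_; _!)
open import Data.Nat.Properties using (_≥?_; _>?_; _!≢0)
import Data.Nat.Properties as ℕP
open import Data.Integer as ℤ using (ℤ; +_; _/ℕ_)
open import Data.List using (List; []; _∷_; map; concatMap; upTo; filter; length; foldr)
open import Data.Nat.ListAction using (sum)
open import Relation.Nullary using (yes; no)
open import Data.List.Relation.Unary.Linked using (Linked; linked?)
open import Data.Product using (_×_)
open import Relation.Nullary.Decidable using (_×-dec_)
open import Relation.Binary.PropositionalEquality using (_≡_)

fallingℤ : ℤ → ℕ → ℤ
fallingℤ x zero    = + 1
fallingℤ x (suc k) = fallingℤ x k ℤ.* (x ℤ.- + k)

binomℤ : ℤ → ℕ → ℤ
binomℤ x k = (fallingℤ x k /ℕ (k !)) {{k !≢0}}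

Σℤ : {A : Set} → List A → (A → ℤ) → ℤ
Σℤ xs f = foldr (λ a s → f a ℤ.+ s) (+ 0) xs

words : ℕ → List ℕ → List (List ℕ)
words zero    A = [] ∷ []
words (suc l) A = concatMap (λ a → map (a ∷_) (words l A)) A

-- Candidate lists: length ≤ n, entries in {1,…,N}.
-- Every partition of n with parts ≤ N is among them (it has ≤ n parts).
candidates : ℕ → ℕ → List (List ℕ)
candidates N n = concatMap (λ l → words l (map suc (upTo N))) (upTo (suc n))

IsPartitionOf : ℕ → List ℕ → Set
IsPartitionOf n xs = Linked _≥_ xs × sum xs ≡ n

IsDistinctPartitionOf : ℕ → List ℕ → Set
IsDistinctPartitionOf n xs = Linked _>_ xs × sum xs ≡ n

Partitions : ℕ → ℕ → List (List ℕ)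
Partitions N n = filter (λ xs → linked? _≥?_ xs ×-dec (sum xs ℕ.≟ n)) (candidates N n)

DistinctPartitions : ℕ → ℕ → List (List ℕ)
DistinctPartitions N n = filter (λ xs → linked? _>?_ xs ×-dec (sum xs ℕ.≟ n)) (candidates N n)

sign : ℕ → ℤ
sign zero    = + 1
sign (suc k) = ℤ.- sign k

δ : ℤ → ℤ → ℤ
δ i j with i ℤ.≟ j
... | yes _ = + 1
... | no  _ = + 0

-- M_{S_2}(m,n) (depending on N): sum over triples (π1,π2,π3), π1 distinct,
-- all parts ≤ N, |π1|+|π2|+|π3| = n, #π2 - #π3 = m, of (-1)^{#π1}.
MS2 : (N : ℕ) → ℤ → ℕ → ℤ
MS2 N m n =
  Σℤ (upTo (suc n)) λ a →
  Σℤ (upTo (suc (n ∸ a))) λ b →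
  Σℤ (DistinctPartitions N a) λ π₁ →
  Σℤ (Partitions N b) λ π₂ →
  Σℤ (Partitions N (n ∸ a ∸ b)) λ π₃ →
    δ (+ length π₂ ℤ.- + length π₃) m ℤ.* sign (length π₁)

μ : (k N n : ℕ) → ℤ
μ k N n =
  Σℤ (upTo (suc (n ℕ.+ n))) λ i →
    let m = + i ℤ.- + n in
    binomℤ (m ℤ.+ + ((k ∸ 1) ℕ./ 2)) k ℤ.* MS2 N m n

{-# OPTIONS --safe #-}
-- The summand m ↦ binom(m + (k-1)/2, k) · M(m,n) of μ is an odd function of m, so its sum over
-- the symmetric range -n ≤ m ≤ n vanishes. Evenness of M(·,n) comes from exchanging π₂ and π₃,
-- which negates the crank. Oddness of the binomial for k = 2j+1 is the reflection formula
-- (k-1-x)^{(k)} = (-1)^k x^{(k)} for falling factorials, at x = m + j. Since binomℤ is defined by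
-- floor division, the formula passes to binomials through the divisibility k! ∣ x^{(k)}, which
-- follows from Pascal's rule for x ≥ 0 and from the reflection formula again for x < 0.
module Submission where

open import Defs
open import Data.Nat using (ℕ; _<_; _≤_; _%_)
open import Data.Integer using (ℤ; +_)
open import Relation.Binary.PropositionalEquality using (_≡_)

open import Data.Nat using (zero; suc; _∸_; _!)
import Data.Nat as ℕ
import Data.Nat.Properties as ℕ
open import Data.Nat.Properties using (_!≢0)
open import Data.Nat.DivMod using (m*n/n≡m; m*n%n≡0; m≡m%n+[m/n]*n)
open import Data.Integer using (-[1+_]; +[1+_]; _+_; _-_; _*_; -_; _/ℕ_; _≟_)
open import Data.Integer.Properties
  using (neg-involutive; neg-injective; neg-distrib-+; neg-distribˡ-*; pos-+; pos-*;
         m-n≡m⊖n; ⊖-≥; *-cancelʳ-≡; +-identityˡ; *-assoc; -1*i≡-i)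
open import Data.Integer.Tactic.RingSolver using (solve-∀)
open import Data.List using (List; []; _∷_; map; applyUpTo; upTo; downFrom; reverse; length)
open import Data.List.Properties using (map-upTo; reverse-upTo)
open import Data.List.Relation.Unary.All using (All; []; _∷_)
open import Data.List.Relation.Unary.All.Properties using (applyUpTo⁺₁)
open import Data.List.Relation.Binary.Permutation.Propositional as ↭ using (_↭_; ↭-sym)
open import Data.List.Relation.Binary.Permutation.Propositional.Properties using (↭-reverse)
open import Data.Product using (∃; _,_)
open import Relation.Binary.PropositionalEquality using (refl; sym; cong; cong₂; module ≡-Reasoning)
import Relation.Binary.PropositionalEquality as ≡
open import Relation.Nullary using (yes; no)
open import Data.Empty using (⊥-elim)
open import Function using (_∘_; id)

open ≡-Reasoning

Σℤ-cong-All : {A : Set} {f g : A → ℤ} {xs : List A} → All (λ x → f x ≡ g x) xs → Σℤ xs f ≡ Σℤ xs g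
Σℤ-cong-All []         = refl
Σℤ-cong-All (eq ∷ eqs) = cong₂ _+_ eq (Σℤ-cong-All eqs)

Σℤ-cong : {A : Set} {f g : A → ℤ} (xs : List A) → (∀ x → f x ≡ g x) → Σℤ xs f ≡ Σℤ xs g
Σℤ-cong []       eq = refl
Σℤ-cong (x ∷ xs) eq = cong₂ _+_ (eq x) (Σℤ-cong xs eq)

Σℤ-zero : {A : Set} (xs : List A) → Σℤ xs (λ _ → + 0) ≡ + 0
Σℤ-zero []       = refl
Σℤ-zero (x ∷ xs) = ≡.trans (+-identityˡ _) (Σℤ-zero xs)

Σℤ-neg : {A : Set} (xs : List A) (f : A → ℤ) → Σℤ xs (λ x → - f x) ≡ - Σℤ xs f
Σℤ-neg []       f = refl
Σℤ-neg (x ∷ xs) f = begin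
  - f x + Σℤ xs (λ x → - f x) ≡⟨ cong (λ s → - f x + s) (Σℤ-neg xs f) ⟩
  - f x + - Σℤ xs f           ≡⟨ sym (neg-distrib-+ (f x) (Σℤ xs f)) ⟩
  - (f x + Σℤ xs f)           ∎

Σℤ-+ : {A : Set} (xs : List A) (f g : A → ℤ) → Σℤ xs (λ x → f x + g x) ≡ Σℤ xs f + Σℤ xs g
Σℤ-+ []       f g = refl
Σℤ-+ (x ∷ xs) f g = begin
  (f x + g x) + Σℤ xs (λ x → f x + g x) ≡⟨ cong (λ s → (f x + g x) + s) (Σℤ-+ xs f g) ⟩
  (f x + g x) + (Σℤ xs f + Σℤ xs g)     ≡⟨ interchange (f x) (g x) (Σℤ xs f) (Σℤ xs g) ⟩
  (f x + Σℤ xs f) + (g x + Σℤ xs g)     ∎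
  where
  interchange : ∀ a b c d → (a + b) + (c + d) ≡ (a + c) + (b + d)
  interchange = solve-∀

Σℤ-swap : {A B : Set} (xs : List A) (ys : List B) (h : A → B → ℤ) →
          Σℤ xs (λ x → Σℤ ys (h x)) ≡ Σℤ ys (λ y → Σℤ xs (λ x → h x y))
Σℤ-swap []       ys h = sym (Σℤ-zero ys)
Σℤ-swap (x ∷ xs) ys h = begin
  Σℤ ys (h x) + Σℤ xs (λ x → Σℤ ys (h x))          ≡⟨ cong (λ s → Σℤ ys (h x) + s) (Σℤ-swap xs ys h) ⟩
  Σℤ ys (h x) + Σℤ ys (λ y → Σℤ xs (λ x → h x y))  ≡⟨ sym (Σℤ-+ ys (h x) _) ⟩
  Σℤ ys (λ y → h x y + Σℤ xs (λ x → h x y))        ∎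

Σℤ-map : {A B : Set} (g : A → B) (xs : List A) (f : B → ℤ) → Σℤ (map g xs) f ≡ Σℤ xs (f ∘ g)
Σℤ-map g []       f = refl
Σℤ-map g (x ∷ xs) f = cong (λ s → f (g x) + s) (Σℤ-map g xs f)

Σℤ-↭ : {A : Set} {xs ys : List A} (f : A → ℤ) → xs ↭ ys → Σℤ xs f ≡ Σℤ ys f
Σℤ-↭ f ↭.refl          = refl
Σℤ-↭ f (↭.prep x p)    = cong (λ s → f x + s) (Σℤ-↭ f p)
Σℤ-↭ f (↭.swap x y p)  =
  ≡.trans (cong (λ s → f x + (f y + s)) (Σℤ-↭ f p)) (left-comm (f x) (f y) _)
  where
  left-comm : ∀ a b c → a + (b + c) ≡ b + (a + c)
  left-comm = solve-∀
Σℤ-↭ f (↭.trans p q)   = ≡.trans (Σℤ-↭ f p) (Σℤ-↭ f q)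

downFrom-suc : ∀ n → downFrom (suc n) ≡ applyUpTo (n ∸_) (suc n)
downFrom-suc zero    = refl
downFrom-suc (suc n) = cong (suc n ∷_) (downFrom-suc n)

Σℤ-upTo-reflect : ∀ n (f : ℕ → ℤ) → Σℤ (upTo (suc n)) f ≡ Σℤ (upTo (suc n)) (λ i → f (n ∸ i))
Σℤ-upTo-reflect n f = begin
  Σℤ (upTo (suc n)) f                  ≡⟨ Σℤ-↭ f (↭-sym (↭-reverse (upTo (suc n)))) ⟩
  Σℤ (reverse (upTo (suc n))) f        ≡⟨ cong (λ xs → Σℤ xs f) (reverse-upTo (suc n)) ⟩
  Σℤ (downFrom (suc n)) f              ≡⟨ cong (λ xs → Σℤ xs f) (downFrom-suc n) ⟩
  Σℤ (applyUpTo (n ∸_) (suc n)) f      ≡⟨ cong (λ xs → Σℤ xs f) (sym (map-upTo (n ∸_) (suc n))) ⟩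
  Σℤ (map (n ∸_) (upTo (suc n))) f     ≡⟨ Σℤ-map (n ∸_) (upTo (suc n)) f ⟩
  Σℤ (upTo (suc n)) (λ i → f (n ∸ i))  ∎

i≡-i⇒i≡0 : ∀ {i} → i ≡ - i → i ≡ + 0
i≡-i⇒i≡0 {+ zero}   _ = refl
i≡-i⇒i≡0 {+[1+ _ ]} ()
i≡-i⇒i≡0 { -[1+ _ ]} ()

Σℤ-upTo-antisymmetric : ∀ n (f : ℕ → ℤ) → (∀ {i} → i ≤ n → f (n ∸ i) ≡ - f i) →
                        Σℤ (upTo (suc n)) f ≡ + 0
Σℤ-upTo-antisymmetric n f antisym = i≡-i⇒i≡0 (begin
  Σℤ (upTo (suc n)) f                  ≡⟨ Σℤ-upTo-reflect n f ⟩
  Σℤ (upTo (suc n)) (λ i → f (n ∸ i))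
    ≡⟨ Σℤ-cong-All {f = λ i → f (n ∸ i)} (applyUpTo⁺₁ id (suc n) (antisym ∘ ℕ.s≤s⁻¹)) ⟩
  Σℤ (upTo (suc n)) (λ i → - f i)      ≡⟨ Σℤ-neg (upTo (suc n)) f ⟩
  - Σℤ (upTo (suc n)) f                ∎)

Σℤ-symmetric-odd : ∀ n (g : ℤ → ℤ) → (∀ m → g (- m) ≡ - g m) →
                   Σℤ (upTo (suc (n ℕ.+ n))) (λ i → g (+ i - + n)) ≡ + 0
Σℤ-symmetric-odd n g g-odd =
  Σℤ-upTo-antisymmetric (n ℕ.+ n) _ (λ i≤2n → ≡.trans (cong g (reflect i≤2n)) (g-odd _))
  where
  reflect : ∀ {i} → i ≤ n ℕ.+ n → + (n ℕ.+ n ∸ i) - + n ≡ - (+ i - + n)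
  reflect {i} i≤2n = begin
    + (n ℕ.+ n ∸ i) - + n        ≡⟨ cong (_- + n) (sym (≡.trans (m-n≡m⊖n (n ℕ.+ n) i) (⊖-≥ i≤2n))) ⟩
    (+ (n ℕ.+ n) - + i) - + n    ≡⟨ cong (λ t → (t - + i) - + n) (pos-+ n n) ⟩
    ((+ n + + n) - + i) - + n    ≡⟨ [a+a-b]-a≡-[b-a] (+ n) (+ i) ⟩
    - (+ i - + n)                ∎
    where
    [a+a-b]-a≡-[b-a] : ∀ a b → ((a + a) - b) - a ≡ - (b - a)
    [a+a-b]-a≡-[b-a] = solve-∀

δ-neg : ∀ x y → δ (- x) (- y) ≡ δ x y
δ-neg x y with x ≟ y | - x ≟ - y
... | yes _   | yes _    = refl
... | no  _   | no  _    = refl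
... | yes x≡y | no -x≢-y = ⊥-elim (-x≢-y (cong -_ x≡y))
... | no  x≢y | yes -x≡-y = ⊥-elim (x≢y (neg-injective -x≡-y))

δ-swap-neg : ∀ p q m → δ (+ p - + q) (- m) ≡ δ (+ q - + p) m
δ-swap-neg p q m = begin
  δ (+ p - + q) (- m)     ≡⟨ cong (λ t → δ t (- m)) (sym (-[a-b]≡b-a (+ q) (+ p))) ⟩
  δ (- (+ q - + p)) (- m) ≡⟨ δ-neg (+ q - + p) m ⟩
  δ (+ q - + p) m         ∎
  where
  -[a-b]≡b-a : ∀ a b → - (a - b) ≡ b - a
  -[a-b]≡b-a = solve-∀

MS2-by-sizes : (N : ℕ) → ℤ → ℕ → ℕ → ℕ → ℤ
MS2-by-sizes N m a b c =
  Σℤ (DistinctPartitions N a) λ π₁ →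
  Σℤ (Partitions N b) λ π₂ →
  Σℤ (Partitions N c) λ π₃ →
    δ (+ length π₂ - + length π₃) m * sign (length π₁)

MS2-by-sizes-neg : ∀ N m a b c → MS2-by-sizes N (- m) a b c ≡ MS2-by-sizes N m a c b
MS2-by-sizes-neg N m a b c = Σℤ-cong (DistinctPartitions N a) λ π₁ →
  ≡.trans (Σℤ-swap (Partitions N b) (Partitions N c) λ π₂ π₃ →
             δ (+ length π₂ - + length π₃) (- m) * sign (length π₁))
          (Σℤ-cong (Partitions N c) λ π₃ → Σℤ-cong (Partitions N b) λ π₂ →
             cong (_* sign (length π₁)) (δ-swap-neg (length π₂) (length π₃) m))

MS2-neg : ∀ N m n → MS2 N (- m) n ≡ MS2 N m n
MS2-neg N m n = Σℤ-cong (upTo (suc n)) λ a → begin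
  Σℤ (upTo (suc (n ∸ a))) (summand (- m) a)
    ≡⟨ Σℤ-upTo-reflect (n ∸ a) (summand (- m) a) ⟩
  Σℤ (upTo (suc (n ∸ a))) (λ b → summand (- m) a (n ∸ a ∸ b))
    ≡⟨ Σℤ-cong-All (applyUpTo⁺₁ id (suc (n ∸ a)) (reflected-summand a ∘ ℕ.s≤s⁻¹)) ⟩
  Σℤ (upTo (suc (n ∸ a))) (summand m a)
    ∎
  where
  summand : ℤ → ℕ → ℕ → ℤ
  summand m′ a b = MS2-by-sizes N m′ a b (n ∸ a ∸ b)

  reflected-summand : ∀ a {b} → b ≤ n ∸ a → summand (- m) a (n ∸ a ∸ b) ≡ summand m a b
  reflected-summand a {b} b≤n-a = begin
    MS2-by-sizes N (- m) a (n ∸ a ∸ b) (n ∸ a ∸ (n ∸ a ∸ b))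
      ≡⟨ cong (MS2-by-sizes N (- m) a (n ∸ a ∸ b)) (ℕ.m∸[m∸n]≡n b≤n-a) ⟩
    MS2-by-sizes N (- m) a (n ∸ a ∸ b) b
      ≡⟨ MS2-by-sizes-neg N m a (n ∸ a ∸ b) b ⟩
    MS2-by-sizes N m a b (n ∸ a ∸ b) ∎

fallingℤ-suc : ∀ x k → fallingℤ x (suc k) ≡ x * fallingℤ (x - + 1) k
fallingℤ-suc x zero    = x-0≡x*1 x
  where
  x-0≡x*1 : ∀ x → + 1 * (x - + 0) ≡ x * + 1
  x-0≡x*1 = solve-∀
fallingℤ-suc x (suc k) = begin
  fallingℤ x (suc k) * (x - + suc k)              ≡⟨ cong (_* (x - + suc k)) (fallingℤ-suc x k) ⟩
  (x * fallingℤ (x - + 1) k) * (x - (+ 1 + + k))  ≡⟨ regroup x (fallingℤ (x - + 1) k) (+ k) ⟩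
  x * (fallingℤ (x - + 1) k * ((x - + 1) - + k))  ∎
  where
  regroup : ∀ x F k → (x * F) * (x - (+ 1 + k)) ≡ x * (F * ((x - + 1) - k))
  regroup = solve-∀

fallingℤ-pascal : ∀ x k → fallingℤ (+ 1 + x) (suc k) ≡ fallingℤ x (suc k) + + suc k * fallingℤ x k
fallingℤ-pascal x zero    = pascal₀ x
  where
  pascal₀ : ∀ x → + 1 * ((+ 1 + x) - + 0) ≡ + 1 * (x - + 0) + + 1 * + 1
  pascal₀ = solve-∀
fallingℤ-pascal x (suc k) = begin
  fallingℤ (+ 1 + x) (suc k) * ((+ 1 + x) - + suc k)
    ≡⟨ cong (_* ((+ 1 + x) - + suc k)) (fallingℤ-pascal x k) ⟩
  (fallingℤ x (suc k) + + suc k * fallingℤ x k) * ((+ 1 + x) - (+ 1 + + k))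
    ≡⟨ expand (fallingℤ x k) x (+ k) ⟩
  fallingℤ x (suc (suc k)) + + suc (suc k) * fallingℤ x (suc k)
    ∎
  where
  expand : ∀ F x k → (F * (x - k) + (+ 1 + k) * F) * ((+ 1 + x) - (+ 1 + k)) ≡
                     F * (x - k) * (x - (+ 1 + k)) + (+ 1 + (+ 1 + k)) * (F * (x - k))
  expand = solve-∀

fallingℤ-reflect : ∀ k x → fallingℤ (+ k - x) (suc k) ≡ sign (suc k) * fallingℤ x (suc k)
fallingℤ-reflect zero    x = reflect₀ x
  where
  reflect₀ : ∀ x → + 1 * ((+ 0 - x) - + 0) ≡ - + 1 * (+ 1 * (x - + 0))
  reflect₀ = solve-∀
fallingℤ-reflect (suc k) x = begin
  fallingℤ (+ suc k - x) (suc (suc k))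
    ≡⟨ fallingℤ-suc (+ suc k - x) (suc k) ⟩
  (+ suc k - x) * fallingℤ ((+ 1 + + k - x) - + 1) (suc k)
    ≡⟨ cong (λ y → (+ suc k - x) * fallingℤ y (suc k)) (shift (+ k) x) ⟩
  (+ suc k - x) * fallingℤ (+ k - x) (suc k)
    ≡⟨ cong ((+ suc k - x) *_) (fallingℤ-reflect k x) ⟩
  (+ 1 + + k - x) * (sign (suc k) * fallingℤ x (suc k))
    ≡⟨ regroup (+ k) x (sign (suc k)) (fallingℤ x (suc k)) ⟩
  sign (suc (suc k)) * fallingℤ x (suc (suc k))
    ∎
  where
  shift : ∀ k x → (+ 1 + k - x) - + 1 ≡ k - x
  shift = solve-∀
  regroup : ∀ k x s F → (+ 1 + k - x) * (s * F) ≡ - s * (F * (x - (+ 1 + k)))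
  regroup = solve-∀

fallingℤ-pos-divisible : ∀ n k → ∃ λ q → fallingℤ (+ n) k ≡ q * + (k !)
fallingℤ-pos-divisible n       zero    = + 1 , refl
fallingℤ-pos-divisible zero    (suc k) = + 0 , fallingℤ-suc (+ 0) k
fallingℤ-pos-divisible (suc n) (suc k)
  with fallingℤ-pos-divisible n (suc k) | fallingℤ-pos-divisible n k
... | q₁ , eq₁ | q₂ , eq₂ = q₁ + q₂ , (begin
  fallingℤ (+ 1 + + n) (suc k)
    ≡⟨ fallingℤ-pascal (+ n) k ⟩
  fallingℤ (+ n) (suc k) + + suc k * fallingℤ (+ n) k
    ≡⟨ cong₂ (λ a b → a + + suc k * b) eq₁ eq₂ ⟩
  q₁ * + (suc k !) + + suc k * (q₂ * + (k !))
    ≡⟨ cong (λ t → q₁ * t + + suc k * (q₂ * + (k !))) (pos-* (suc k) (k !)) ⟩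
  q₁ * (+ suc k * + (k !)) + + suc k * (q₂ * + (k !))
    ≡⟨ factor q₁ q₂ (+ suc k) (+ (k !)) ⟩
  (q₁ + q₂) * (+ suc k * + (k !))
    ≡⟨ cong ((q₁ + q₂) *_) (sym (pos-* (suc k) (k !))) ⟩
  (q₁ + q₂) * + (suc k !) ∎)
  where
  factor : ∀ q₁ q₂ s f → q₁ * (s * f) + s * (q₂ * f) ≡ (q₁ + q₂) * (s * f)
  factor = solve-∀

fallingℤ-divisible : ∀ x k → ∃ λ q → fallingℤ x k ≡ q * + (k !)
fallingℤ-divisible (+ n)    k       = fallingℤ-pos-divisible n k
fallingℤ-divisible -[1+ m ] zero    = + 1 , refl
fallingℤ-divisible -[1+ m ] (suc k) with fallingℤ-pos-divisible (suc m ℕ.+ k) (suc k)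
... | q , eq = sign (suc k) * q , (begin
  fallingℤ -[1+ m ] (suc k)
    ≡⟨ cong (λ y → fallingℤ y (suc k)) (sym reflected) ⟩
  fallingℤ (+ k - + (suc m ℕ.+ k)) (suc k)
    ≡⟨ fallingℤ-reflect k (+ (suc m ℕ.+ k)) ⟩
  sign (suc k) * fallingℤ (+ (suc m ℕ.+ k)) (suc k)
    ≡⟨ cong (sign (suc k) *_) eq ⟩
  sign (suc k) * (q * + (suc k !))
    ≡⟨ sym (*-assoc (sign (suc k)) q (+ (suc k !))) ⟩
  sign (suc k) * q * + (suc k !) ∎)
  where
  k-[s+k]≡-s : ∀ k s → k - (s + k) ≡ - s
  k-[s+k]≡-s = solve-∀
  reflected : + k - + (suc m ℕ.+ k) ≡ -[1+ m ]
  reflected = ≡.trans (cong (λ t → + k - t) (pos-+ (suc m) k)) (k-[s+k]≡-s (+ k) (+ suc m))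

-[1+m]/ℕn≡-[[1+m]/n] : ∀ m n .{{_ : ℕ.NonZero n}} → suc m % n ≡ 0 → -[1+ m ] /ℕ n ≡ - + (suc m ℕ./ n)
-[1+m]/ℕn≡-[[1+m]/n] m n n∣1+m with suc m % n | n∣1+m
... | .0 | refl = refl

i*n/ℕn≡i : ∀ i n .{{_ : ℕ.NonZero n}} → (i * + n) /ℕ n ≡ i
i*n/ℕn≡i (+ m)     n       = ≡.trans (cong (_/ℕ n) (sym (pos-* m n))) (cong +_ (m*n/n≡m m n))
i*n/ℕn≡i -[1+ m ] (suc n) =
  ≡.trans (-[1+m]/ℕn≡-[[1+m]/n] (n ℕ.+ m ℕ.* suc n) (suc n) (m*n%n≡0 (suc m) (suc n)))
          (cong (-_ ∘ +_) (m*n/n≡m (suc m) (suc n)))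

fallingℤ≡binomℤ*k! : ∀ x k → fallingℤ x k ≡ binomℤ x k * + (k !)
fallingℤ≡binomℤ*k! x k with fallingℤ-divisible x k
... | q , eq = begin
  fallingℤ x k                     ≡⟨ eq ⟩
  q * + (k !)                      ≡⟨ cong (_* + (k !)) (sym (i*n/ℕn≡i q (k !))) ⟩
  ((q * + (k !)) /ℕ k !) * + (k !) ≡⟨ cong (λ t → (t /ℕ k !) * + (k !)) (sym eq) ⟩
  binomℤ x k * + (k !)             ∎
  where instance _ = k !≢0

binomℤ-reflect : ∀ k x → binomℤ (+ k - x) (suc k) ≡ sign (suc k) * binomℤ x (suc k)
binomℤ-reflect k x = *-cancelʳ-≡ _ _ (+ (suc k !)) (begin
  binomℤ (+ k - x) (suc k) * + (suc k !)        ≡⟨ sym (fallingℤ≡binomℤ*k! (+ k - x) (suc k)) ⟩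
  fallingℤ (+ k - x) (suc k)                    ≡⟨ fallingℤ-reflect k x ⟩
  sign (suc k) * fallingℤ x (suc k)             ≡⟨ cong (sign (suc k) *_) (fallingℤ≡binomℤ*k! x (suc k)) ⟩
  sign (suc k) * (binomℤ x (suc k) * + (suc k !)) ≡⟨ sym (*-assoc (sign (suc k)) _ _) ⟩
  sign (suc k) * binomℤ x (suc k) * + (suc k !)   ∎)
  where instance _ = suc k !≢0

sign-even : ∀ j → sign (j ℕ.* 2) ≡ + 1
sign-even zero    = refl
sign-even (suc j) = ≡.trans (neg-involutive _) (sign-even j)

binomℤ-odd : ∀ j x → binomℤ (- x + + j) (suc (j ℕ.* 2)) ≡ - binomℤ (x + + j) (suc (j ℕ.* 2))
binomℤ-odd j x = begin
  binomℤ (- x + + j) k                       ≡⟨ cong (λ y → binomℤ y k) reflected ⟩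
  binomℤ (+ (j ℕ.* 2) - (x + + j)) k         ≡⟨ binomℤ-reflect (j ℕ.* 2) (x + + j) ⟩
  - sign (j ℕ.* 2) * binomℤ (x + + j) k      ≡⟨ cong (λ s → - s * binomℤ (x + + j) k) (sign-even j) ⟩
  - + 1 * binomℤ (x + + j) k                 ≡⟨ -1*i≡-i (binomℤ (x + + j) k) ⟩
  - binomℤ (x + + j) k                       ∎
  where
  k = suc (j ℕ.* 2)
  -x+j≡2j-[x+j] : ∀ x j → - x + j ≡ j * + 2 - (x + j)
  -x+j≡2j-[x+j] = solve-∀
  reflected : - x + + j ≡ + (j ℕ.* 2) - (x + + j)
  reflected = ≡.trans (-x+j≡2j-[x+j] x (+ j)) (cong (λ t → t - (x + + j)) (sym (pos-* j 2)))

μ-odd : ∀ j N n → μ (suc (j ℕ.* 2)) N n ≡ + 0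
μ-odd j N n = Σℤ-symmetric-odd n summand summand-odd
  where
  k = suc (j ℕ.* 2)
  J = (k ∸ 1) ℕ./ 2
  summand : ℤ → ℤ
  summand m = binomℤ (m + + J) k * MS2 N m n
  summand-odd : ∀ m → summand (- m) ≡ - summand m
  summand-odd m = begin
    binomℤ (- m + + J) k * MS2 N (- m) n  ≡⟨ cong (λ i → binomℤ (- m + + i) k * MS2 N (- m) n) J≡j ⟩
    binomℤ (- m + + j) k * MS2 N (- m) n  ≡⟨ cong₂ _*_ (binomℤ-odd j m) (MS2-neg N m n) ⟩
    - binomℤ (m + + j) k * MS2 N m n      ≡⟨ sym (neg-distribˡ-* (binomℤ (m + + j) k) (MS2 N m n)) ⟩
    - (binomℤ (m + + j) k * MS2 N m n)    ≡⟨ cong (λ i → - (binomℤ (m + + i) k * MS2 N m n)) (sym J≡j) ⟩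
    - summand m                           ∎
    where
    J≡j : J ≡ j
    J≡j = m*n/n≡m j 2

-- μ vanishes for every N and n.
proposition2p3 : (N k : ℕ) → 0 < N → k % 2 ≡ 1 →
    (n : ℕ) → 1 ≤ n → μ k N n ≡ + 0
proposition2p3 N k _ k%2≡1 n _ = ≡.subst (λ k → μ k N n ≡ + 0) (sym k≡1+[k/2]*2) (μ-odd (k ℕ./ 2) N n)
  where
  k≡1+[k/2]*2 : k ≡ suc (k ℕ./ 2 ℕ.* 2)
  k≡1+[k/2]*2 = ≡.trans (m≡m%n+[m/n]*n k 2) (cong (ℕ._+ (k ℕ./ 2 ℕ.* 2)) k%2≡1)
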